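{- Let $(V,\mathcal{C})$ be a $4$-cycle system and let $j$ and $d$ be positive integers. Then every $(j+3,j+d)$-configuration in $(V,\mathcal{C})$ contains a $(j+3,j)$-configuration as a substructure; that is, if $\mathcal{A}\subseteq\mathcal{C}$ consists of $j+d$ $4$-cycles whose union has exactly $j+3$ vertices, then there is a subset $\mathcal{A}'\subseteq\mathcal{A}$ of exactly $j$ $4$-cycles whose union has exactly $j+3$ vertices.
   Context: A $4$-cycle is a cycle of length four in a graph, written $(a,b,c,d)$ with edges $\{a,b\},\{b,c\},\{c,d\},\{d,a\}$. A $4$-cycle system of order $v$, $4\mathrm{CS}(v)$, is a pair $(V,\mathcal{C})$ where $V$ is the vertex set of the complete graph $K_v$ and $\mathcal{C}$ is a collection of edge-disjoint $4$-cycles whose edges partition the edge set of $K_v$. A $(k,l)$-configuration is a set of $l$ pairwise edge-disjoint $4$-cycles whose union contains precisely $k$ vertices; a $(k,l)$-configuration in a $4$CS is such a subset of its $4$-cycles. -}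

module Defs where

open import Data.Nat using (ℕ; zero; suc)
open import Data.Fin using (Fin; zero; suc)
open import Data.Fin.Subset using (Subset; ⊥; ⁅_⁆; _∪_; inside; outside)
open import Data.Vec using (_∷_; [])
open import Data.Product using (Σ; _×_; ∃)
open import Data.Sum using (_⊎_)
open import Relation.Binary.PropositionalEquality using (_≡_; _≢_)

-- A 4-cycle (a,b,c,d) on vertex set Fin v: four distinct vertices,
-- with edges {a,b},{b,c},{c,d},{d,a}.
record Cycle4 (v : ℕ) : Set where
  constructor cyc
  field
    a b c d : Fin v
    a≢b : a ≢ b
    a≢c : a ≢ c
    a≢d : a ≢ d
    b≢c : b ≢ c
    b≢d : b ≢ d
    c≢d : c ≢ d

open Cycle4 public

SamePair : ∀ {v} → Fin v → Fin v → Fin v → Fin v → Set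
SamePair x y p q = (x ≡ p × y ≡ q) ⊎ (x ≡ q × y ≡ p)

HasEdge : ∀ {v} → Cycle4 v → Fin v → Fin v → Set
HasEdge C x y =
  SamePair x y (a C) (b C) ⊎ SamePair x y (b C) (c C) ⊎
  SamePair x y (c C) (d C) ⊎ SamePair x y (d C) (a C)

vertices : ∀ {v} → Cycle4 v → Subset v
vertices C = ⁅ a C ⁆ ∪ ⁅ b C ⁆ ∪ ⁅ c C ⁆ ∪ ⁅ d C ⁆

-- A 4-cycle system of order v: a family of n 4-cycles (indexed by Fin n)
-- whose edges partition the edge set of K_v: every edge {x,y} (x ≢ y)
-- lies in exactly one cycle of the family.
Is4CS : (v n : ℕ) → (Fin n → Cycle4 v) → Set
Is4CS v n cs =
  (x y : Fin v) → x ≢ y →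
    ∃ (λ i → HasEdge (cs i) x y) ×
    ((i i′ : Fin n) → HasEdge (cs i) x y → HasEdge (cs i′) x y → i ≡ i′)

unionVerts : ∀ {v n} → (Fin n → Cycle4 v) → Subset n → Subset v
unionVerts {n = zero} cs [] = ⊥
unionVerts {n = suc n} cs (inside ∷ S) = vertices (cs zero) ∪ unionVerts (λ i → cs (suc i)) S
unionVerts {n = suc n} cs (outside ∷ S) = unionVerts (λ i → cs (suc i)) S

-- A 4-cycle has four vertices, and a cycle whose vertex set is not covered by
-- the other cycles of a family contributes at least one new vertex. Hence a
-- nonempty family in which no cycle is covered by the others spans at least
-- (number of cycles) + 3 vertices. A (j+3, j+d)-configuration with d ≥ 1 is
-- too small for that, so some cycle is covered by the others and can be
-- dropped without changing the vertex set; after d such steps a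
-- (j+3, j)-configuration remains.
module Submission where

open import Defs
open import Data.Nat using (ℕ; zero; suc; _+_; _≥_; _≤_; _<_; z≤n; s≤s)
open import Data.Nat.Properties
  using (≤-trans; ≤-reflexive; +-suc; +-identityʳ; +-monoˡ-<; m<m+n; <⇒≱; suc-injective)
open import Data.Fin using (Fin)
open import Data.Fin.Properties using (any?)
open import Data.Fin.Subset
  using (Subset; ∣_∣; _⊆_; _∈_; _∉_; _∪_; ⁅_⁆; inside; outside)
open import Data.Fin.Subset.Properties
  using ( _∈?_; ⊆-refl; ⊆-antisym; out⊆; in⊆in; q⊆p∪q; x∈p∪q⁻; x∈p∪q⁺
        ; x∈⁅x⁆; x≢y⇒x∉⁅y⁆; ∣⁅x⁆∣≡1; ∣p∣≤∣p∪q∣; p⊂q⇒∣p∣<∣q∣ )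
open import Data.Vec using (_∷_; [])
open import Data.Product using (Σ; ∃; _×_; _,_)
open import Data.Sum using (_⊎_; inj₁; inj₂)
open import Relation.Nullary using (yes; no; ¬?; _×-dec_; contradiction)
open import Relation.Nullary.Decidable using (decidable-stable)
open import Relation.Binary.PropositionalEquality
  using (_≡_; refl; sym; trans; cong; subst)

∪-least : ∀ {n} {p q r : Subset n} → p ⊆ r → q ⊆ r → p ∪ q ⊆ r
∪-least {p = p} {q} p⊆r q⊆r x∈p∪q with x∈p∪q⁻ p q x∈p∪q
... | inj₁ x∈p = p⊆r x∈p
... | inj₂ x∈q = q⊆r x∈q

p⊆q⇒p∪q≡q : ∀ {n} {p q : Subset n} → p ⊆ q → p ∪ q ≡ q
p⊆q⇒p∪q≡q {p = p} {q} p⊆q = ⊆-antisym (∪-least p⊆q (λ x∈q → x∈q)) (q⊆p∪q p q)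

x∉p⇒x∉q⇒x∉p∪q : ∀ {n} {x : Fin n} {p q} → x ∉ p → x ∉ q → x ∉ p ∪ q
x∉p⇒x∉q⇒x∉p∪q {p = p} {q} x∉p x∉q x∈p∪q with x∈p∪q⁻ p q x∈p∪q
... | inj₁ x∈p = x∉p x∈p
... | inj₂ x∈q = x∉q x∈q

⊆⊎∃∉ : ∀ {n} (p q : Subset n) → p ⊆ q ⊎ ∃ λ x → x ∈ p × x ∉ q
⊆⊎∃∉ p q with any? (λ x → x ∈? p ×-dec ¬? (x ∈? q))
... | yes outsider = inj₂ outsider
... | no none = inj₁ λ {x} x∈p → decidable-stable (x ∈? q) (λ x∉q → none (x , x∈p , x∉q))

∣p∣<∣q∪p∣ : ∀ {n} (p q : Subset n) {x} → x ∈ q → x ∉ p → ∣ p ∣ < ∣ q ∪ p ∣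
∣p∣<∣q∪p∣ p q {x} x∈q x∉p = p⊂q⇒∣p∣<∣q∣ (q⊆p∪q q p , x , x∈p∪q⁺ (inj₁ x∈q) , x∉p)

∣p∣<∣⁅x⁆∪p∣ : ∀ {n} {x : Fin n} {p} → x ∉ p → ∣ p ∣ < ∣ ⁅ x ⁆ ∪ p ∣
∣p∣<∣⁅x⁆∪p∣ {x = x} {p} = ∣p∣<∣q∪p∣ p ⁅ x ⁆ (x∈⁅x⁆ x)

∣vertices∣≥4 : ∀ {v} (C : Cycle4 v) → ∣ vertices C ∣ ≥ 4
∣vertices∣≥4 (cyc a b c d a≢b a≢c a≢d b≢c b≢d c≢d) =
  ∣p∣<∣⁅x⁆∪p∣ (x≢y⇒x∉⁅y⁆ a≢b ∉∪ x≢y⇒x∉⁅y⁆ a≢c ∉∪ x≢y⇒x∉⁅y⁆ a≢d) ∘<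
  ∣p∣<∣⁅x⁆∪p∣ (x≢y⇒x∉⁅y⁆ b≢c ∉∪ x≢y⇒x∉⁅y⁆ b≢d) ∘<
  ∣p∣<∣⁅x⁆∪p∣ (x≢y⇒x∉⁅y⁆ c≢d) ∘<
  ≤-reflexive (sym (∣⁅x⁆∣≡1 d))
  where
  _∉∪_ : ∀ {p q} {x : Fin _} → x ∉ p → x ∉ q → x ∉ p ∪ q
  _∉∪_ = x∉p⇒x∉q⇒x∉p∪q
  infixr 5 _∉∪_
  _∘<_ : ∀ {m n k} → n < k → m ≤ n → suc m ≤ k
  n<k ∘< m≤n = ≤-trans (s≤s m≤n) n<k
  infixr 4 _∘<_

HasRedundantCycle : ∀ {v n} → (Fin n → Cycle4 v) → Subset n → Set
HasRedundantCycle cs A =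
  Σ (Subset _) λ A′ → A′ ⊆ A × suc ∣ A′ ∣ ≡ ∣ A ∣ × unionVerts cs A′ ≡ unionVerts cs A

hasRedundantCycle⊎∣unionVerts∣≥ : ∀ {v n} (cs : Fin n → Cycle4 v) (A : Subset n) →
  HasRedundantCycle cs A ⊎ (∣ A ∣ ≥ 1 → ∣ unionVerts cs A ∣ ≥ ∣ A ∣ + 3)
hasRedundantCycle⊎∣unionVerts∣≥ {n = zero} cs [] = inj₂ λ ()
hasRedundantCycle⊎∣unionVerts∣≥ {n = suc n} cs (outside ∷ S)
  with hasRedundantCycle⊎∣unionVerts∣≥ (λ i → cs (Fin.suc i)) S
... | inj₁ (S′ , S′⊆S , ∣S′∣ , U′≡U) = inj₁ (outside ∷ S′ , out⊆ S′⊆S , ∣S′∣ , U′≡U)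
... | inj₂ large = inj₂ large
hasRedundantCycle⊎∣unionVerts∣≥ {n = suc n} cs (inside ∷ S)
  with hasRedundantCycle⊎∣unionVerts∣≥ (λ i → cs (Fin.suc i)) S
... | inj₁ (S′ , S′⊆S , ∣S′∣ , U′≡U) =
  inj₁ (inside ∷ S′ , in⊆in S′⊆S , cong suc ∣S′∣ , cong (vertices (cs Fin.zero) ∪_) U′≡U)
... | inj₂ large with ⊆⊎∃∉ (vertices (cs Fin.zero)) (unionVerts (λ i → cs (Fin.suc i)) S)
...   | inj₁ C₀⊆U = inj₁ (outside ∷ S , out⊆ ⊆-refl , refl , sym (p⊆q⇒p∪q≡q C₀⊆U))
...   | inj₂ (x , x∈C₀ , x∉U) = inj₂ λ _ → grow ∣ S ∣ large
  where
  C₀ = vertices (cs Fin.zero)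
  U = unionVerts (λ i → cs (Fin.suc i)) S
  grow : ∀ k → (k ≥ 1 → ∣ U ∣ ≥ k + 3) → ∣ C₀ ∪ U ∣ ≥ suc k + 3
  grow zero _ = ≤-trans (∣vertices∣≥4 (cs Fin.zero)) (∣p∣≤∣p∪q∣ C₀ U)
  grow (suc k) large = ≤-trans (s≤s (large (s≤s z≤n))) (∣p∣<∣q∪p∣ U C₀ x∈C₀ x∉U)

removeRedundantCycles : ∀ {v n} (cs : Fin n → Cycle4 v) (j d : ℕ) (A : Subset n) →
  ∣ A ∣ ≡ j + d → ∣ unionVerts cs A ∣ ≡ j + 3 →
  Σ (Subset n) λ A′ → A′ ⊆ A × ∣ A′ ∣ ≡ j × unionVerts cs A′ ≡ unionVerts cs A
removeRedundantCycles cs j zero A ∣A∣ _ = A , ⊆-refl , trans ∣A∣ (+-identityʳ j) , refl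
removeRedundantCycles cs j (suc d) A ∣A∣ ∣U∣ with hasRedundantCycle⊎∣unionVerts∣≥ cs A
... | inj₂ large = contradiction (large nonempty) (<⇒≱ too-few)
  where
  ∣A∣≡1+j+d : ∣ A ∣ ≡ suc (j + d)
  ∣A∣≡1+j+d = trans ∣A∣ (+-suc j d)
  nonempty : ∣ A ∣ ≥ 1
  nonempty = subst (_≥ 1) (sym ∣A∣≡1+j+d) (s≤s z≤n)
  too-few : ∣ unionVerts cs A ∣ < ∣ A ∣ + 3
  too-few = subst (_< ∣ A ∣ + 3) (sym ∣U∣)
    (subst (λ a → j + 3 < a + 3) (sym ∣A∣) (+-monoˡ-< 3 (m<m+n j (s≤s z≤n))))
... | inj₁ (A′ , A′⊆A , ∣A′∣ , U′≡U)
  with removeRedundantCycles cs j d A′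
         (suc-injective (trans ∣A′∣ (trans ∣A∣ (+-suc j d))))
         (trans (cong ∣_∣ U′≡U) ∣U∣)
...   | A″ , A″⊆A′ , ∣A″∣ , U″≡U′ = A″ , (λ x∈A″ → A′⊆A (A″⊆A′ x∈A″)) , ∣A″∣ , trans U″≡U′ U′≡U

proposition2 : (v n : ℕ) (cs : Fin n → Cycle4 v) → Is4CS v n cs →
    (j d : ℕ) → j ≥ 1 → d ≥ 1 →
    (A : Subset n) → ∣ A ∣ ≡ j + d → ∣ unionVerts cs A ∣ ≡ j + 3 →
    Σ (Subset n) (λ A′ → A′ ⊆ A × ∣ A′ ∣ ≡ j × ∣ unionVerts cs A′ ∣ ≡ j + 3)
proposition2 v n cs _ j d _ _ A ∣A∣ ∣U∣
  with removeRedundantCycles cs j d A ∣A∣ ∣U∣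
... | A′ , A′⊆A , ∣A′∣ , U′≡U = A′ , A′⊆A , ∣A′∣ , trans (cong ∣_∣ U′≡U) ∣U∣
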